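{- For every finite simple graph $G$ and positive integer $m$, if $\mathrm{bc}(G)=m$, then $\mathrm{bp}(G)\le \frac{1}{2}(3^m-1)$.
   Context: A biclique of a graph $G$ is a complete bipartite subgraph of $G$. A biclique cover of $G$ is a collection of bicliques of $G$ the union of whose edge sets is $E(G)$; a biclique partition is a collection of bicliques of $G$ whose edge sets partition $E(G)$. $\mathrm{bc}(G)$ (the biclique cover number) is the least number of bicliques in a biclique cover of $G$, and $\mathrm{bp}(G)$ (the biclique partition number) is the least number of bicliques in a biclique partition of $G$. -}

module Defs where

open import Data.Nat using (ℕ; _<_)
open import Data.Fin using (Fin)
open import Data.Fin.Subset using (Subset; _∈_; _∉_; Nonempty)
open import Data.List using (List; length; lookup)
open import Data.Product using (Σ; _×_; ∃)
open import Data.Sum using (_⊎_)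
open import Relation.Binary.PropositionalEquality using (_≡_)
open import Relation.Nullary using (¬_)
open import Level using (0ℓ; suc)

record Graph (n : ℕ) : Set₁ where
  field
    Adj    : Fin n → Fin n → Set
    sym    : ∀ {u v} → Adj u v → Adj v u
    irrefl : ∀ {u} → ¬ Adj u u
open Graph public

record Biclique {n : ℕ} (G : Graph n) : Set where
  field
    partA    : Subset n
    partB    : Subset n
    nonemptyA : Nonempty partA
    nonemptyB : Nonempty partB
    disjoint : ∀ v → v ∈ partA → v ∉ partB
    complete : ∀ a b → a ∈ partA → b ∈ partB → Adj G a b
open Biclique public

_∈E_ : ∀ {n} {G : Graph n} → Fin n × Fin n → Biclique G → Set
_∈E_ {G = G} (u Data.Product., v) K =
  (u ∈ partA K × v ∈ partB K) ⊎ (u ∈ partB K × v ∈ partA K)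

IsBicliqueCover : ∀ {n} (G : Graph n) → List (Biclique G) → Set
IsBicliqueCover {n} G Ks =
  ∀ (u v : Fin n) → Adj G u v → ∃ λ (i : Fin (length Ks)) → (u Data.Product., v) ∈E lookup Ks i

IsBicliquePartition : ∀ {n} (G : Graph n) → List (Biclique G) → Set
IsBicliquePartition {n} G Ks =
  IsBicliqueCover G Ks ×
  (∀ (u v : Fin n) → Adj G u v → ∀ (i j : Fin (length Ks)) →
     (u Data.Product., v) ∈E lookup Ks i → (u Data.Product., v) ∈E lookup Ks j → i ≡ j)

bc≡ : ∀ {n} → Graph n → ℕ → Set
bc≡ G m =
  (Σ (List (Biclique G)) λ Ks → IsBicliqueCover G Ks × length Ks ≡ m) ×
  (∀ (Ks : List (Biclique G)) → IsBicliqueCover G Ks → ¬ (length Ks < m))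

bp≤ : ∀ {n} → Graph n → ℕ → Set
bp≤ G k = Σ (List (Biclique G)) λ Ks → IsBicliquePartition G Ks × length Ks Data.Nat.≤ k

-- Let K₁, …, Kₘ be a biclique cover. Build a partition P(K₁, …, Kₘ) of the
-- edges covered by the Kᵢ as K₁ followed by every biclique of P(K₂, …, Kₘ)
-- with the edges of K₁ cut away. Removing K₁ = (C, D) from a biclique R = (A, B)
-- leaves three bicliques, with A-sides A ∖ (C ∪ D), A ∩ C and A ∩ D and
-- B-sides B, B ∖ D and B ∖ C. So the partition has at most
-- 1 + 3 + ⋯ + 3ᵐ⁻¹ = (3ᵐ − 1)/2 members.
module Submission where

open import Defs
open import Data.Nat using (ℕ; zero; suc; _+_; _*_; _∸_; _^_; _/_; _≤_; z≤n; s≤s; NonZero)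
open import Data.Nat.Properties
  using (≤-trans; ≤-reflexive; +-mono-≤; *-monoʳ-≤; *-suc; module ≤-Reasoning)
open import Data.Nat.DivMod using (m*n/n≡m)
open import Data.Nat.Tactic.RingSolver using (solve-∀)
open import Data.Fin using (Fin; zero; suc)
open import Data.Fin.Subset using (Subset; _∈_; _∉_; _⊆_; Nonempty; _∩_; _∪_; ∁; ⊤)
open import Data.Fin.Subset.Properties
  using (_∈?_; nonempty?; ∈⊤; p∩q⊆p; p∩q⊆q; x∈p∩q⁺; x∈p∪q⁺; x∈p∪q⁻; x∈∁p⇒x∉p; x∉p⇒x∈∁p)
open import Data.List using (List; []; _∷_; _++_; length; lookup)
open import Data.List.Properties using (length-++)
open import Data.List.Relation.Unary.Any as Any using (Any; here; there)
open import Data.List.Relation.Unary.Any.Properties using (++⁺ˡ; ++⁺ʳ; ++⁻; lookup-index)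
open import Data.List.Membership.Propositional using (lose)
open import Data.List.Membership.Propositional.Properties using (∈-lookup)
open import Data.Product using (_×_; _,_; proj₁; proj₂)
open import Data.Sum as Sum using (_⊎_; inj₁; inj₂; [_,_])
open import Function using (_∘_)
open import Level using (Level; _⊔_)
open import Relation.Nullary using (¬_; Dec; yes; no; contradiction)
open import Relation.Nullary.Decidable using (_×-dec_; _⊎-dec_)
open import Relation.Binary.PropositionalEquality using (_≡_; refl; cong; module ≡-Reasoning)

repunit₃ : ℕ → ℕ
repunit₃ zero    = zero
repunit₃ (suc k) = suc (3 * repunit₃ k)

suc-repunit₃*2≡3^ : ∀ k → suc (repunit₃ k * 2) ≡ 3 ^ k
suc-repunit₃*2≡3^ zero    = refl
suc-repunit₃*2≡3^ (suc k) = begin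
  suc (suc (3 * repunit₃ k) * 2)  ≡⟨ rearrange (repunit₃ k) ⟩
  3 * suc (repunit₃ k * 2)        ≡⟨ cong (3 *_) (suc-repunit₃*2≡3^ k) ⟩
  3 * 3 ^ k                       ∎
  where
  open ≡-Reasoning
  rearrange : ∀ x → suc (suc (3 * x) * 2) ≡ 3 * suc (x * 2)
  rearrange = solve-∀

repunit₃≡ : ∀ k → repunit₃ k ≡ (3 ^ k ∸ 1) / 2
repunit₃≡ k = begin
  repunit₃ k          ≡⟨ m*n/n≡m (repunit₃ k) 2 ⟨
  repunit₃ k * 2 / 2  ≡⟨ cong (λ x → (x ∸ 1) / 2) (suc-repunit₃*2≡3^ k) ⟩
  (3 ^ k ∸ 1) / 2     ∎
  where open ≡-Reasoning

data AtMostOne {a p : Level} {A : Set a} (P : A → Set p) : List A → Set (a ⊔ p) where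
  []  : AtMostOne P []
  _∷_ : ∀ {x xs} → (P x → ¬ Any P xs) → AtMostOne P xs → AtMostOne P (x ∷ xs)

module _ {a p : Level} {A : Set a} {P : A → Set p} where

  atMostOne-≤1 : ∀ {xs} → length xs ≤ 1 → AtMostOne P xs
  atMostOne-≤1 {[]}         _         = []
  atMostOne-≤1 {x ∷ []}     _         = (λ _ ()) ∷ []
  atMostOne-≤1 {x ∷ y ∷ xs} (s≤s ())

  atMostOne-++ : ∀ {xs ys} → AtMostOne P xs → AtMostOne P ys →
                 (Any P xs → ¬ Any P ys) → AtMostOne P (xs ++ ys)
  atMostOne-++ []                   amo-ys _   = amo-ys
  atMostOne-++ {x ∷ xs} (h ∷ amo-xs) amo-ys sep =
    (λ px → [ h px , sep (here px) ] ∘ ++⁻ xs) ∷ atMostOne-++ amo-xs amo-ys (sep ∘ there)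

  atMostOne-lookup : ∀ {xs} → AtMostOne P xs → ∀ {i j} →
                     P (lookup xs i) → P (lookup xs j) → i ≡ j
  atMostOne-lookup (_ ∷ _)   {zero}  {zero}  _  _  = refl
  atMostOne-lookup (h ∷ _)   {zero}  {suc j} px py = contradiction (lose (∈-lookup j) py) (h px)
  atMostOne-lookup (h ∷ _)   {suc i} {zero}  px py = contradiction (lose (∈-lookup i) px) (h py)
  atMostOne-lookup (_ ∷ amo) {suc i} {suc j} px py = cong suc (atMostOne-lookup amo px py)

module _ {n : ℕ} {G : Graph n} where

  -- e ∈E K unfolds to Between (partA K) (partB K) e.
  Between : Subset n → Subset n → Fin n × Fin n → Set
  Between A B (u , v) = (u ∈ A × v ∈ B) ⊎ (u ∈ B × v ∈ A)

  Between-sym : ∀ {A B u v} → Between A B (u , v) → Between A B (v , u)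
  Between-sym (inj₁ (u∈A , v∈B)) = inj₂ (v∈B , u∈A)
  Between-sym (inj₂ (u∈B , v∈A)) = inj₁ (v∈A , u∈B)

  Between-mono : ∀ {A A′ B B′ e} → A′ ⊆ A → B′ ⊆ B → Between A′ B′ e → Between A B e
  Between-mono A′⊆A B′⊆B (inj₁ (u∈A′ , v∈B′)) = inj₁ (A′⊆A u∈A′ , B′⊆B v∈B′)
  Between-mono A′⊆A B′⊆B (inj₂ (u∈B′ , v∈A′)) = inj₂ (B′⊆B u∈B′ , A′⊆A v∈A′)

  Between-nonempty : ∀ {A B} e → Between A B e → Nonempty A × Nonempty B
  Between-nonempty (u , v) (inj₁ (u∈A , v∈B)) = (u , u∈A) , (v , v∈B)
  Between-nonempty (u , v) (inj₂ (u∈B , v∈A)) = (v , v∈A) , (u , u∈B)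

  _∈E?_ : (e : Fin n × Fin n) (K : Biclique G) → Dec (e ∈E K)
  (u , v) ∈E? K = (u ∈? partA K ×-dec v ∈? partB K) ⊎-dec (u ∈? partB K ×-dec v ∈? partA K)

  subBiclique : (R : Biclique G) (X Y : Subset n) →
                Nonempty (partA R ∩ X) → Nonempty (partB R ∩ Y) → Biclique G
  subBiclique R X Y neA neB = record
    { partA     = partA R ∩ X
    ; partB     = partB R ∩ Y
    ; nonemptyA = neA
    ; nonemptyB = neB
    ; disjoint  = λ v v∈A v∈B → disjoint R v (p∩q⊆p _ _ v∈A) (p∩q⊆p _ _ v∈B)
    ; complete  = λ a b a∈A b∈B → complete R a b (p∩q⊆p _ _ a∈A) (p∩q⊆p _ _ b∈B)
    }

  restrict : Biclique G → Subset n → Subset n → List (Biclique G)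
  restrict R X Y with nonempty? (partA R ∩ X) | nonempty? (partB R ∩ Y)
  ... | yes neA | yes neB = subBiclique R X Y neA neB ∷ []
  ... | _       | _       = []

  restrict-length : ∀ R X Y → length (restrict R X Y) ≤ 1
  restrict-length R X Y with nonempty? (partA R ∩ X) | nonempty? (partB R ∩ Y)
  ... | yes _ | yes _ = s≤s z≤n
  ... | yes _ | no  _ = z≤n
  ... | no  _ | _     = z≤n

  restrict-edges⁻ : ∀ {e} R X Y → Any (e ∈E_) (restrict R X Y) →
                    Between (partA R ∩ X) (partB R ∩ Y) e
  restrict-edges⁻ R X Y e∈ with nonempty? (partA R ∩ X) | nonempty? (partB R ∩ Y) | e∈
  ... | yes _ | yes _ | here e∈K = e∈K

  restrict-edges⁺ : ∀ {e} R X Y → Between (partA R ∩ X) (partB R ∩ Y) e →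
                    Any (e ∈E_) (restrict R X Y)
  restrict-edges⁺ {e} R X Y e∈ with nonempty? (partA R ∩ X) | nonempty? (partB R ∩ Y)
  ... | yes _   | yes _   = here e∈
  ... | yes _   | no ¬neB = contradiction (proj₂ (Between-nonempty e e∈)) ¬neB
  ... | no ¬neA | _       = contradiction (proj₁ (Between-nonempty e e∈)) ¬neA

  restrict-∋ : ∀ R {X Y a b} → a ∈ partA R → b ∈ partB R → a ∈ X → b ∈ Y →
               Any ((a , b) ∈E_) (restrict R X Y)
  restrict-∋ R a∈A b∈B a∈X b∈Y = restrict-edges⁺ R _ _ (inj₁ (x∈p∩q⁺ (a∈A , a∈X) , x∈p∩q⁺ (b∈B , b∈Y)))

  restrict-⊆ : ∀ {e} R X Y → Any (e ∈E_) (restrict R X Y) → e ∈E R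
  restrict-⊆ R X Y = Between-mono (p∩q⊆p _ _) (p∩q⊆p _ _) ∘ restrict-edges⁻ R X Y

  restrict-disjoint : ∀ {e} R {X₁ Y₁ X₂ Y₂} → (∀ v → v ∈ X₁ → v ∉ X₂) →
                      Any (e ∈E_) (restrict R X₁ Y₁) → ¬ Any (e ∈E_) (restrict R X₂ Y₂)
  restrict-disjoint {u , v} R {X₁} {Y₁} {X₂} {Y₂} X₁∩X₂≡∅ e∈₁ e∈₂ =
    separate (restrict-edges⁻ R X₁ Y₁ e∈₁) (restrict-edges⁻ R X₂ Y₂ e∈₂)
    where
    separate : Between (partA R ∩ X₁) (partB R ∩ Y₁) (u , v) →
               ¬ Between (partA R ∩ X₂) (partB R ∩ Y₂) (u , v)
    separate (inj₁ (u∈₁ , _)) (inj₁ (u∈₂ , _)) = X₁∩X₂≡∅ u (p∩q⊆q _ _ u∈₁) (p∩q⊆q _ _ u∈₂)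
    separate (inj₁ (u∈₁ , _)) (inj₂ (u∈₂ , _)) = disjoint R u (p∩q⊆p _ _ u∈₁) (p∩q⊆p _ _ u∈₂)
    separate (inj₂ (u∈₁ , _)) (inj₁ (u∈₂ , _)) = disjoint R u (p∩q⊆p _ _ u∈₂) (p∩q⊆p _ _ u∈₁)
    separate (inj₂ (_ , v∈₁)) (inj₂ (_ , v∈₂)) = X₁∩X₂≡∅ v (p∩q⊆q _ _ v∈₁) (p∩q⊆q _ _ v∈₂)

  restrict-avoids : ∀ {e} R {X Y} (K : Biclique G) →
                    (∀ {a b} → a ∈ X → b ∈ Y → ¬ (a , b) ∈E K) →
                    Any (e ∈E_) (restrict R X Y) → ¬ e ∈E K
  restrict-avoids {u , v} R {X} {Y} K X×Y∩K≡∅ e∈ with restrict-edges⁻ R X Y e∈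
  ... | inj₁ (u∈ , v∈) = X×Y∩K≡∅ (p∩q⊆q _ _ u∈) (p∩q⊆q _ _ v∈)
  ... | inj₂ (u∈ , v∈) = X×Y∩K≡∅ (p∩q⊆q _ _ v∈) (p∩q⊆q _ _ u∈) ∘ Between-sym

  split : Biclique G → Biclique G → List (Biclique G)
  split K R =  restrict R (∁ (partA K ∪ partB K)) ⊤
            ++ restrict R (partA K) (∁ (partB K))
            ++ restrict R (partB K) (∁ (partA K))

  module _ (K R : Biclique G) where

    private
      C D : Subset n
      C = partA K
      D = partB K

      piece₀ piece₁ piece₂ : List (Biclique G)
      piece₀ = restrict R (∁ (C ∪ D)) ⊤
      piece₁ = restrict R C (∁ D)
      piece₂ = restrict R D (∁ C)

      Any-split⁻ : ∀ {e} → Any (e ∈E_) (split K R) →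
                   Any (e ∈E_) piece₀ ⊎ Any (e ∈E_) piece₁ ⊎ Any (e ∈E_) piece₂
      Any-split⁻ = Sum.map₂ (++⁻ piece₁) ∘ ++⁻ piece₀

      outside-C∪D : ∀ {v} → v ∈ ∁ (C ∪ D) → v ∉ C × v ∉ D
      outside-C∪D v∉ = x∈∁p⇒x∉p v∉ ∘ x∈p∪q⁺ ∘ inj₁ , x∈∁p⇒x∉p v∉ ∘ x∈p∪q⁺ ∘ inj₂

    split-⊆ : ∀ {e} → Any (e ∈E_) (split K R) → e ∈E R
    split-⊆ = [ restrict-⊆ R _ _ , [ restrict-⊆ R _ _ , restrict-⊆ R _ _ ] ] ∘ Any-split⁻

    split-avoids : ∀ {e} → Any (e ∈E_) (split K R) → ¬ e ∈E K
    split-avoids = [ restrict-avoids R K avoids₀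
                   , [ restrict-avoids R K avoids₁ , restrict-avoids R K avoids₂ ] ] ∘ Any-split⁻
      where
      avoids₀ : ∀ {a b} → a ∈ ∁ (C ∪ D) → b ∈ ⊤ → ¬ (a , b) ∈E K
      avoids₀ a∉ _ (inj₁ (a∈C , _)) = proj₁ (outside-C∪D a∉) a∈C
      avoids₀ a∉ _ (inj₂ (a∈D , _)) = proj₂ (outside-C∪D a∉) a∈D
      avoids₁ : ∀ {a b} → a ∈ C → b ∈ ∁ D → ¬ (a , b) ∈E K
      avoids₁ _   b∉D (inj₁ (_ , b∈D)) = x∈∁p⇒x∉p b∉D b∈D
      avoids₁ a∈C _   (inj₂ (a∈D , _)) = disjoint K _ a∈C a∈D
      avoids₂ : ∀ {a b} → a ∈ D → b ∈ ∁ C → ¬ (a , b) ∈E K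
      avoids₂ a∈D _   (inj₁ (a∈C , _)) = disjoint K _ a∈C a∈D
      avoids₂ _   b∉C (inj₂ (_ , b∈C)) = x∈∁p⇒x∉p b∉C b∈C

    split-atMostOne : ∀ {e} → AtMostOne (e ∈E_) (split K R)
    split-atMostOne =
      atMostOne-++ (atMostOne-≤1 (restrict-length R _ _))
        (atMostOne-++ (atMostOne-≤1 (restrict-length R _ _)) (atMostOne-≤1 (restrict-length R _ _))
          (restrict-disjoint R (λ v v∈C v∈D → disjoint K v v∈C v∈D)))
        (λ e∈₀ → [ restrict-disjoint R (λ v v∉ → proj₁ (outside-C∪D v∉)) e∈₀
                 , restrict-disjoint R (λ v v∉ → proj₂ (outside-C∪D v∉)) e∈₀ ] ∘ ++⁻ piece₁)

    split-length : length (split K R) ≤ 3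
    split-length = begin
      length (piece₀ ++ piece₁ ++ piece₂)                ≡⟨ length-++ piece₀ ⟩
      length piece₀ + length (piece₁ ++ piece₂)          ≡⟨ cong (length piece₀ +_) (length-++ piece₁) ⟩
      length piece₀ + (length piece₁ + length piece₂)    ≤⟨ +-mono-≤ (restrict-length R _ _)
                                                             (+-mono-≤ (restrict-length R _ _) (restrict-length R _ _)) ⟩
      3                                                  ∎
      where open ≤-Reasoning

  split-covers-oriented : ∀ K R {a b} → a ∈ partA R → b ∈ partB R → ¬ (a , b) ∈E K →
                          Any ((a , b) ∈E_) (split K R)
  split-covers-oriented K R {a} {b} a∈A b∈B ab∉K with a ∈? partA K | a ∈? partB K
  ... | yes a∈C | _       = ++⁺ʳ (restrict R _ _) (++⁺ˡ (restrict-∋ R a∈A b∈B a∈C b∉D))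
    where
    b∉D : b ∈ ∁ (partB K)
    b∉D = x∉p⇒x∈∁p (λ b∈D → ab∉K (inj₁ (a∈C , b∈D)))
  ... | no _    | yes a∈D = ++⁺ʳ (restrict R _ _) (++⁺ʳ (restrict R _ _) (restrict-∋ R a∈A b∈B a∈D b∉C))
    where
    b∉C : b ∈ ∁ (partA K)
    b∉C = x∉p⇒x∈∁p (λ b∈C → ab∉K (inj₂ (a∈D , b∈C)))
  ... | no a∉C  | no a∉D  = ++⁺ˡ (restrict-∋ R a∈A b∈B a∉C∪D ∈⊤)
    where
    a∉C∪D : a ∈ ∁ (partA K ∪ partB K)
    a∉C∪D = x∉p⇒x∈∁p ([ a∉C , a∉D ] ∘ x∈p∪q⁻ _ _)

  split-covers : ∀ K R {e} → e ∈E R → ¬ e ∈E K → Any (e ∈E_) (split K R)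
  split-covers K R (inj₁ (u∈A , v∈B)) e∉K = split-covers-oriented K R u∈A v∈B e∉K
  split-covers K R (inj₂ (u∈B , v∈A)) e∉K =
    Any.map Between-sym (split-covers-oriented K R v∈A u∈B (e∉K ∘ Between-sym))

  refine : Biclique G → List (Biclique G) → List (Biclique G)
  refine K []       = []
  refine K (R ∷ Rs) = split K R ++ refine K Rs

  module _ {e : Fin n × Fin n} (K : Biclique G) where

    refine-⊆ : ∀ Rs → Any (e ∈E_) (refine K Rs) → Any (e ∈E_) Rs
    refine-⊆ (R ∷ Rs) = [ here ∘ split-⊆ K R , there ∘ refine-⊆ Rs ] ∘ ++⁻ (split K R)

    refine-avoids : ∀ Rs → Any (e ∈E_) (refine K Rs) → ¬ e ∈E K
    refine-avoids (R ∷ Rs) = [ split-avoids K R , refine-avoids Rs ] ∘ ++⁻ (split K R)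

    refine-covers : ∀ {Rs} → ¬ e ∈E K → Any (e ∈E_) Rs → Any (e ∈E_) (refine K Rs)
    refine-covers e∉K (here {x = R} e∈R) = ++⁺ˡ (split-covers K R e∈R e∉K)
    refine-covers e∉K (there {x = R} e∈Rs) = ++⁺ʳ (split K R) (refine-covers e∉K e∈Rs)

    refine-atMostOne : ∀ {Rs} → AtMostOne (e ∈E_) Rs → AtMostOne (e ∈E_) (refine K Rs)
    refine-atMostOne []                   = []
    refine-atMostOne {R ∷ Rs} (h ∷ amo) =
      atMostOne-++ (split-atMostOne K R) (refine-atMostOne amo)
        (λ e∈split → h (split-⊆ K R e∈split) ∘ refine-⊆ Rs)

  refine-length : ∀ K Rs → length (refine K Rs) ≤ 3 * length Rs
  refine-length K []       = z≤n
  refine-length K (R ∷ Rs) = begin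
    length (split K R ++ refine K Rs)         ≡⟨ length-++ (split K R) ⟩
    length (split K R) + length (refine K Rs) ≤⟨ +-mono-≤ (split-length K R) (refine-length K Rs) ⟩
    3 + 3 * length Rs                         ≡⟨ *-suc 3 (length Rs) ⟨
    3 * suc (length Rs)                       ∎
    where open ≤-Reasoning

  partition : List (Biclique G) → List (Biclique G)
  partition []       = []
  partition (K ∷ Ks) = K ∷ refine K (partition Ks)

  partition-covers : ∀ {e Ks} → Any (e ∈E_) Ks → Any (e ∈E_) (partition Ks)
  partition-covers (here e∈K) = here e∈K
  partition-covers {e} (there {x = K} e∈Ks) with e ∈E? K
  ... | yes e∈K = here e∈K
  ... | no e∉K  = there (refine-covers K e∉K (partition-covers e∈Ks))

  partition-atMostOne : ∀ {e} Ks → AtMostOne (e ∈E_) (partition Ks)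
  partition-atMostOne []       = []
  partition-atMostOne (K ∷ Ks) =
    (λ e∈K e∈rest → refine-avoids K (partition Ks) e∈rest e∈K)
      ∷ refine-atMostOne K (partition-atMostOne Ks)

  partition-length : ∀ Ks → length (partition Ks) ≤ repunit₃ (length Ks)
  partition-length []       = z≤n
  partition-length (K ∷ Ks) =
    s≤s (≤-trans (refine-length K (partition Ks)) (*-monoʳ-≤ 3 (partition-length Ks)))

  cover⇒partition : ∀ Ks → IsBicliqueCover G Ks → IsBicliquePartition G (partition Ks)
  cover⇒partition Ks cover = covers , λ _ _ _ _ _ → atMostOne-lookup (partition-atMostOne Ks)
    where
    covers : IsBicliqueCover G (partition Ks)
    covers u v uv∈G with cover u v uv∈G
    ... | i , uv∈Kᵢ = Any.index uv∈partition , lookup-index uv∈partition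
      where
      uv∈partition : Any ((u , v) ∈E_) (partition Ks)
      uv∈partition = partition-covers (lose (∈-lookup i) uv∈Kᵢ)

mainTheorem4 : ∀ (n : ℕ) (G : Graph n) (m : ℕ) → NonZero m → bc≡ G m →
    bp≤ G ((3 ^ m ∸ 1) / 2)
mainTheorem4 n G m _ ((Ks , cover , refl) , _) =
  partition Ks , cover⇒partition Ks cover ,
  ≤-trans (partition-length Ks) (≤-reflexive (repunit₃≡ (length Ks)))
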